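{- Let $A, B \in \Gamma_\theta$, let $S = \begin{pmatrix} 0 & -1 \\ 1 & 0\end{pmatrix}$, and put $A' = AS$, $B' = SB$. Write $c_A, c_B, c_{AB}, c_{A'}, c_{B'}, c_{A'B'}$ for the lower-left entries of $A, B, AB, A', B', A'B'$ respectively. Then $$\mathfrak{S}(AB) - \mathfrak{S}(A) - \mathfrak{S}(B) = -\mathrm{sign}(c_A c_B c_{AB})$$ holds if and only if $$\mathfrak{S}(A'B') - \mathfrak{S}(A') - \mathfrak{S}(B') = -\mathrm{sign}(c_{A'} c_{B'} c_{A'B'})$$ holds.
   Context: $\Gamma_\theta = \{\begin{pmatrix} a&b\\c&d\end{pmatrix}\in \mathrm{SL}_2(\mathbf{Z}) : a\equiv d,\ b\equiv c \pmod 2\}$ (note $S\in\Gamma_\theta$). For $A=\begin{pmatrix} a&b\\c&d\end{pmatrix}\in\Gamma_\theta$, $\mathfrak{S}(A)=\sum_{k=1}^{|c|-1}(-1)^{\lfloor ka/c\rfloor+k+1}$ if $c\neq 0$, and $\mathfrak{S}(A)=0$ if $c=0$. $\mathrm{sign}(0)=0$. -}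

module Defs where

open import Data.Nat as ℕ using (ℕ; zero; suc)
open import Data.Integer hiding (suc)
open import Data.Integer.Properties using ()
open import Data.Product using (_×_)
open import Data.List using (List; map; foldr; upTo)
open import Relation.Binary.PropositionalEquality using (_≡_)

record M2 : Set where
  constructor mat
  field
    a b c d : ℤ
open M2 public

_·_ : M2 → M2 → M2
mat a₁ b₁ c₁ d₁ · mat a₂ b₂ c₂ d₂ =
  mat (a₁ * a₂ + b₁ * c₂) (a₁ * b₂ + b₁ * d₂)
      (c₁ * a₂ + d₁ * c₂) (c₁ * b₂ + d₁ * d₂)

det : M2 → ℤ
det (mat a b c d) = a * d - b * c

S : M2
S = mat 0ℤ -1ℤ 1ℤ 0ℤ

_≡₂_ : ℤ → ℤ → Set
x ≡₂ y = (x - y) % (+ 2) ≡ 0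

InΓθ : M2 → Set
InΓθ A = det A ≡ 1ℤ × (a A ≡₂ d A) × (b A ≡₂ c A)

negOnePow : ℤ → ℤ
negOnePow n with n % (+ 2)
... | zero = 1ℤ
... | suc _ = -1ℤ

-- floor (x / c) for c ≠ 0 (zero for c = 0, never used)
floorDiv : ℤ → ℤ → ℤ
floorDiv x (+ zero) = 0ℤ
floorDiv x (+ (suc n)) = x /ℕ suc n
floorDiv x -[1+ n ] = (- x) /ℕ suc n

-- 𝔖(A) = Σ_{k=1}^{|c|-1} (-1)^(⌊ka/c⌋ + k + 1), and 0 if c = 0
𝔖 : M2 → ℤ
𝔖 (mat a b c d) =
  foldr _+_ 0ℤ (map (λ j → let k = + (suc j) in negOnePow (floorDiv (k * a) c + k + 1ℤ))
           (upTo (∣ c ∣ ℕ.∸ 1)))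

sgn : ℤ → ℤ
sgn (+ zero) = 0ℤ
sgn (+ suc _) = 1ℤ
sgn -[1+ _ ] = -1ℤ

Rel : M2 → M2 → Set
Rel A B = 𝔖 (A · B) - 𝔖 A - 𝔖 B ≡ - sgn (c A * c B * c (A · B))

-- Since S² = -1, A′B′ = -AB, and 𝔖 is unchanged when a matrix is negated, so 𝔖(A′B′) = 𝔖(AB).
-- For A, B ∈ Γθ one has 𝔖(AS) = 𝔖(A) - sgn(c_A d_A) and 𝔖(SB) = 𝔖(B) - sgn(a_B c_B). Both rest on
-- the reciprocity law 𝔰(x, y) + 𝔰(y, x) = sgn(xy) for coprime x, y of opposite parity, where 𝔰(a, c)
-- is 𝔖 of a matrix with first column (a, c); it comes from telescoping (-1)^(⌊n/x⌋ + ⌊n/y⌋) over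
-- 0 ≤ n < xy. The first identity also needs a Euclidean descent on |c_A| through the moves
-- A ↦ (1 2t; 0 1) A and A ↦ S A. So passing from (A, B) to (A′, B′) adds
-- sgn(c_A d_A) + sgn(a_B c_B) to the left-hand side of the relation, and a finite identity between
-- the signs of the entries shows that it adds the same to the right-hand side.

module Submission where

open import Defs
open import Data.Empty using (⊥; ⊥-elim)
open import Data.Integer hiding (suc)
open import Data.Integer using () renaming (suc to sucℤ)
open import Data.Integer.DivMod using (a≡a%ℕn+[a/ℕn]*n; [n/ℕd]*d≤n; n<s[n/ℕd]*d; n%ℕd<d)
open import Data.Integer.Divisibility.Signed using (_∣_; divides; ∣-refl; ∣n⇒∣m*n; ∣m∣n⇒∣m+n; ∣⇒∣ᵤ; ∣ᵤ⇒∣)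
open import Data.Integer.Properties
open import Algebra.Properties.AbelianGroup +-0-abelianGroup using (∙-cancelʳ; ⁻¹-anti-homo‿-)
open import Data.Integer.Tactic.RingSolver using (solve-∀)
open import Data.List using (List; []; _∷_; map; foldr; applyUpTo)
open import Data.List.Membership.Propositional using (_∈_)
open import Data.List.Relation.Unary.All using (All; all?; lookup)
open import Data.List.Relation.Unary.Any using (here; there)
open import Data.Nat as ℕ using (ℕ; zero; suc)
import Data.Nat.Divisibility as ℕ using (∣⇒≤; n∣m*n; m%n≡0⇒n∣m)
import Data.Nat.DivMod as ℕ
import Data.Nat.Properties as ℕ
import Data.Nat.Tactic.RingSolver as ℕ-Solver
open import Data.Product using (∃; ∃₂; _×_; _,_; proj₁)
open import Data.Sum using (_⊎_; inj₁; inj₂)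
open import Function using (_∘_; id)
open import Function.Bundles using (_⇔_; mk⇔)
open import Relation.Binary.PropositionalEquality
open import Relation.Nullary using (¬_; yes; no)
open import Relation.Nullary.Decidable using (from-yes; _⊎-dec_; _×-dec_; _→-dec_; ¬?)

open ≡-Reasoning

infix 8 -1^_

-1^_ : ℤ → ℤ
-1^ (+ zero)              = 1ℤ
-1^ (+ suc zero)          = -1ℤ
-1^ (+ suc (suc m))       = -1^ (+ m)
-1^ -[1+ zero ]           = -1ℤ
-1^ -[1+ suc zero ]       = 1ℤ
-1^ -[1+ suc (suc m) ]    = -1^ -[1+ m ]

negOnePow≡-1^ : ∀ n → negOnePow n ≡ -1^ n
negOnePow≡-1^ (+ zero)             = refl
negOnePow≡-1^ (+ suc zero)         = refl
negOnePow≡-1^ (+ suc (suc m))      = negOnePow≡-1^ (+ m)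
negOnePow≡-1^ -[1+ zero ]          = refl
negOnePow≡-1^ -[1+ suc zero ]      = refl
negOnePow≡-1^ -[1+ suc (suc m) ]   = negOnePow≡-1^ -[1+ m ]

-1^-+suc : ∀ m → -1^ (+ suc m) ≡ - -1^ (+ m)
-1^-+suc zero          = refl
-1^-+suc (suc zero)    = refl
-1^-+suc (suc (suc m)) = -1^-+suc m

-1^--suc : ∀ m → -1^ -[1+ suc m ] ≡ - -1^ -[1+ m ]
-1^--suc zero          = refl
-1^--suc (suc zero)    = refl
-1^--suc (suc (suc m)) = -1^--suc m

-1^-suc : ∀ n → -1^ (n + 1ℤ) ≡ - -1^ n
-1^-suc (+ m)            = trans (cong (-1^_ ∘ +_) (ℕ.+-comm m 1)) (-1^-+suc m)
-1^-suc -[1+ zero ]      = refl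
-1^-suc -[1+ suc m ]     = begin
  -1^ -[1+ m ]              ≡⟨ neg-involutive _ ⟨
  - - -1^ -[1+ m ]          ≡⟨ cong -_ (-1^--suc m) ⟨
  - -1^ -[1+ suc m ]        ∎

-1^-pred : ∀ n → -1^ (n - 1ℤ) ≡ - -1^ n
-1^-pred n = begin
  -1^ (n - 1ℤ)              ≡⟨ neg-involutive _ ⟨
  - - -1^ (n - 1ℤ)          ≡⟨ cong -_ (-1^-suc (n - 1ℤ)) ⟨
  - -1^ (n - 1ℤ + 1ℤ)       ≡⟨ cong (-_ ∘ -1^_) (cancel n) ⟩
  - -1^ n                   ∎
  where
  cancel : ∀ n → n - 1ℤ + 1ℤ ≡ n
  cancel = solve-∀

-1^-+ : ∀ m n → -1^ (m + n) ≡ -1^ m * -1^ n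
-1^-+ m (+ zero)      = trans (cong -1^_ (+-identityʳ m)) (sym (*-identityʳ _))
-1^-+ m (+ suc k)     = begin
  -1^ (m + + suc k)         ≡⟨ cong -1^_ (shift m (+ k)) ⟩
  -1^ (m + + k + 1ℤ)        ≡⟨ -1^-suc (m + + k) ⟩
  - -1^ (m + + k)           ≡⟨ cong -_ (-1^-+ m (+ k)) ⟩
  - (-1^ m * -1^ (+ k))     ≡⟨ neg-distribʳ-* (-1^ m) _ ⟩
  -1^ m * - -1^ (+ k)       ≡⟨ cong (-1^ m *_) (-1^-+suc k) ⟨
  -1^ m * -1^ (+ suc k)     ∎
  where
  shift : ∀ m k → m + (1ℤ + k) ≡ m + k + 1ℤ
  shift = solve-∀
-1^-+ m -[1+ zero ]   = trans (-1^-pred m) (trans (sym (-1*i≡-i _)) (*-comm -1ℤ _))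
-1^-+ m -[1+ suc k ]  = begin
  -1^ (m + -[1+ suc k ])    ≡⟨ cong -1^_ shift ⟩
  -1^ (m + -[1+ k ] - 1ℤ)   ≡⟨ -1^-pred (m + -[1+ k ]) ⟩
  - -1^ (m + -[1+ k ])      ≡⟨ cong -_ (-1^-+ m -[1+ k ]) ⟩
  - (-1^ m * -1^ -[1+ k ])  ≡⟨ neg-distribʳ-* (-1^ m) _ ⟩
  -1^ m * - -1^ -[1+ k ]    ≡⟨ cong (-1^ m *_) (-1^--suc k) ⟨
  -1^ m * -1^ -[1+ suc k ]  ∎
  where
  shift : m + -[1+ suc k ] ≡ m + -[1+ k ] - 1ℤ
  shift = trans (cong (λ i → m + -[1+ suc i ]) (sym (ℕ.+-identityʳ k))) (sym (+-assoc m -[1+ k ] -1ℤ))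

-1^-involutive : ∀ n → -1^ n * -1^ n ≡ 1ℤ
-1^-involutive (+ zero)            = refl
-1^-involutive (+ suc zero)        = refl
-1^-involutive (+ suc (suc m))     = -1^-involutive (+ m)
-1^-involutive -[1+ zero ]         = refl
-1^-involutive -[1+ suc zero ]     = refl
-1^-involutive -[1+ suc (suc m) ]  = -1^-involutive -[1+ m ]

-1^-even : ∀ t → -1^ (t + t) ≡ 1ℤ
-1^-even t = trans (-1^-+ t t) (-1^-involutive t)

-1^-+-even : ∀ n t → -1^ (n + (t + t)) ≡ -1^ n
-1^-+-even n t = begin
  -1^ (n + (t + t))           ≡⟨ -1^-+ n (t + t) ⟩
  -1^ n * -1^ (t + t)         ≡⟨ cong (-1^ n *_) (trans (-1^-+ t t) (-1^-involutive t)) ⟩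
  -1^ n * 1ℤ                  ≡⟨ *-identityʳ (-1^ n) ⟩
  -1^ n                       ∎

-1^-odd : ∀ t → -1^ (t + t + 1ℤ) ≡ -1ℤ
-1^-odd t = trans (-1^-suc (t + t)) (cong -_ (-1^-even t))

-1^-neg-suc : ∀ m → -1^ -[1+ m ] ≡ -1^ +[1+ m ]
-1^-neg-suc zero           = refl
-1^-neg-suc (suc zero)     = refl
-1^-neg-suc (suc (suc m))  = -1^-neg-suc m

-1^-neg : ∀ n → -1^ (- n) ≡ -1^ n
-1^-neg (+ zero)  = refl
-1^-neg +[1+ m ]  = -1^-neg-suc m
-1^-neg -[1+ m ]  = sym (-1^-neg-suc m)

even-or-odd : ∀ x → ∃ λ t → x ≡ t + t ⊎ x ≡ t + t + 1ℤ
even-or-odd x with x %ℕ 2 | n%ℕd<d x 2 | a≡a%ℕn+[a/ℕn]*n x 2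
... | 0           | _                         | x≡ = x /ℕ 2 , inj₁ (trans x≡ (even (x /ℕ 2)))
  where
  even : ∀ q → + 0 + q * + 2 ≡ q + q
  even = solve-∀
... | 1           | _                         | x≡ = x /ℕ 2 , inj₂ (trans x≡ (odd (x /ℕ 2)))
  where
  odd : ∀ q → + 1 + q * + 2 ≡ q + q + 1ℤ
  odd = solve-∀
... | suc (suc _) | ℕ.s≤s (ℕ.s≤s ())        | _

-1^-square : ∀ x → -1^ (x * x) ≡ -1^ x
-1^-square x with even-or-odd x
... | t , inj₁ refl = trans (cong -1^_ (square (t + t) t)) (trans (-1^-even ((t + t) * t)) (sym (-1^-even t)))
  where
  square : ∀ x t → x * (t + t) ≡ x * t + x * t
  square = solve-∀
... | t , inj₂ refl = trans (cong -1^_ (square t)) (trans (-1^-odd (t + t + t * (t + t))) (sym (-1^-odd t)))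
  where
  square : ∀ t → (t + t + 1ℤ) * (t + t + 1ℤ) ≡ (t + t + t * (t + t)) + (t + t + t * (t + t)) + 1ℤ
  square = solve-∀

≡₂⇒+even : ∀ x y → x ≡₂ y → ∃ λ t → x ≡ y + (t + t)
≡₂⇒+even x y x-y%2≡0 = q , (begin
  x                            ≡⟨ shift x y ⟩
  y + (x - y)                  ≡⟨ cong (_+_ y) (a≡a%ℕn+[a/ℕn]*n (x - y) 2) ⟩
  y + (+ r + q * + 2)          ≡⟨ cong (λ i → y + (+ i + q * + 2)) x-y%2≡0 ⟩
  y + (+ 0 + q * + 2)          ≡⟨ cong (_+_ y) (double q) ⟩
  y + (q + q)                  ∎)
  where
  r = (x - y) %ℕ 2
  q = (x - y) /ℕ 2
  shift : ∀ x y → x ≡ y + (x - y)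
  shift = solve-∀
  double : ∀ q → + 0 + q * + 2 ≡ q + q
  double = solve-∀

OppositeParity : ℤ → ℤ → Set
OppositeParity x y = -1^ x * -1^ y ≡ -1ℤ

OppositeParity-shift : ∀ x y t → OppositeParity x y → OppositeParity (x + (t + t) * y) y
OppositeParity-shift x y t x≢₂y =
  trans (cong (λ z → -1^ z * -1^ y) (regroup x y t)) (trans (cong (_* -1^ y) (-1^-+-even x (t * y))) x≢₂y)
  where
  regroup : ∀ x y t → x + (t + t) * y ≡ x + (t * y + t * y)
  regroup = solve-∀

OppositeParity-sym : ∀ x y → OppositeParity x y → OppositeParity y x
OppositeParity-sym x y x≢₂y = trans (*-comm (-1^ y) (-1^ x)) x≢₂y

OppositeParity-swap : ∀ x y → OppositeParity x y → OppositeParity (- y) x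
OppositeParity-swap x y x≢₂y = trans (cong (_* -1^ x) (-1^-neg y)) (OppositeParity-sym x y x≢₂y)

¬OppositeParity-neg : ∀ x → ¬ OppositeParity (- x) x
¬OppositeParity-neg x opposite with trans (sym (trans (cong (_* -1^ x) (-1^-neg x)) (-1^-involutive x))) opposite
... | ()

/ℕ-unique : ∀ n d .{{_ : ℕ.NonZero d}} q → q * + d ≤ n → n < + d + q * + d → n /ℕ d ≡ q
/ℕ-unique n d q lo hi = ≤-antisym (below (≤-<-trans ([n/ℕd]*d≤n n d) hi′)) (below (≤-<-trans lo (n<s[n/ℕd]*d n d)))
  where
  hi′ : n < sucℤ q * + d
  hi′ = subst (n <_) (sym (suc-* q (+ d))) hi
  below : ∀ {i j} → i * + d < sucℤ j * + d → i ≤ j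
  below {i} {j} lt = subst (i ≤_) (pred-suc j) (i<j⇒i≤pred[j] {i} {sucℤ j} (*-cancelʳ-<-nonNeg (+ d) lt))

/ℕ-+-* : ∀ z w d .{{_ : ℕ.NonZero d}} → (z + w * + d) /ℕ d ≡ z /ℕ d + w
/ℕ-+-* z w d = /ℕ-unique (z + w * + d) d (q + w) lo hi
  where
  q = z /ℕ d
  lo : (q + w) * + d ≤ z + w * + d
  lo = subst (_≤ z + w * + d) (sym (*-distribʳ-+ (+ d) q w)) (+-monoˡ-≤ (w * + d) ([n/ℕd]*d≤n z d))
  hi : z + w * + d < + d + (q + w) * + d
  hi = subst (z + w * + d <_) (expand (+ d) q w) (+-monoˡ-< (w * + d) (n<s[n/ℕd]*d z d))
    where
    expand : ∀ D q w → (1ℤ + q) * D + w * D ≡ D + (q + w) * D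
    expand = solve-∀

/ℕ-neg : ∀ z d .{{_ : ℕ.NonZero d}} → z ≢ (z /ℕ d) * + d → (- z) /ℕ d ≡ - (z /ℕ d) - 1ℤ
/ℕ-neg z d z≢qd = /ℕ-unique (- z) d (- q - 1ℤ) lo hi
  where
  q = z /ℕ d
  lo : (- q - 1ℤ) * + d ≤ - z
  lo = subst (_≤ - z) (expand (+ d) q) (neg-mono-≤ (<⇒≤ (n<s[n/ℕd]*d z d)))
    where
    expand : ∀ D q → - ((1ℤ + q) * D) ≡ (- q - 1ℤ) * D
    expand = solve-∀
  hi : - z < + d + (- q - 1ℤ) * + d
  hi = subst (- z <_) (expand (+ d) q) (neg-mono-< (≤∧≢⇒< ([n/ℕd]*d≤n z d) (z≢qd ∘ sym)))
    where
    expand : ∀ D q → - (q * D) ≡ D + (- q - 1ℤ) * D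
    expand = solve-∀

[r+kn]%n≡r : ∀ r k n .{{_ : ℕ.NonZero n}} → r ℕ.< n → (r ℕ.+ k ℕ.* n) ℕ.% n ≡ r
[r+kn]%n≡r r k n r<n = trans (ℕ.[m+kn]%n≡m%n r k n) (ℕ.m<n⇒m%n≡m r<n)

[r+kn]/n≡k : ∀ r k n .{{_ : ℕ.NonZero n}} → r ℕ.< n → (r ℕ.+ k ℕ.* n) ℕ./ n ≡ k
[r+kn]/n≡k r k n r<n = trans (ℕ.+-distrib-/-∣ʳ r (ℕ.n∣m*n k)) (cong₂ ℕ._+_ (ℕ.m<n⇒m/n≡0 r<n) (ℕ.m*n/n≡m k n))

suc-/-% : ∀ N X .{{_ : ℕ.NonZero X}} →
  (suc N ℕ.% X ≡ 0 × suc N ℕ./ X ≡ suc (N ℕ./ X)) ⊎ (∃ λ r → suc N ℕ.% X ≡ suc r × suc N ℕ./ X ≡ N ℕ./ X)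
suc-/-% N X with ℕ.m≤n⇒m<n∨m≡n (ℕ.m%n<n N X)
... | inj₁ 1+r<X = inj₂ (N ℕ.% X , trans (cong (ℕ._% X) N≡) ([r+kn]%n≡r _ (N ℕ./ X) X 1+r<X)
                                   , trans (cong (ℕ._/ X) N≡) ([r+kn]/n≡k _ (N ℕ./ X) X 1+r<X))
  where
  N≡ : suc N ≡ suc (N ℕ.% X) ℕ.+ (N ℕ./ X) ℕ.* X
  N≡ = cong suc (ℕ.m≡m%n+[m/n]*n N X)
... | inj₂ 1+r≡X = inj₁ (trans (cong (ℕ._% X) N≡) (ℕ.m*n%n≡0 (suc (N ℕ./ X)) X)
                       , trans (cong (ℕ._/ X) N≡) (ℕ.m*n/n≡m (suc (N ℕ./ X)) X))
  where
  N≡ : suc N ≡ suc (N ℕ./ X) ℕ.* X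
  N≡ = trans (cong suc (ℕ.m≡m%n+[m/n]*n N X)) (cong (ℕ._+ (N ℕ./ X) ℕ.* X) 1+r≡X)

∑ : ℕ → (ℕ → ℤ) → ℤ
∑ zero    g = 0ℤ
∑ (suc m) g = g 0 + ∑ m (g ∘ suc)
infix 5 ∑
syntax ∑ m (λ i → e) = ∑[ i < m ] e

foldr-+-applyUpTo : ∀ m (g : ℕ → ℤ) (h : ℕ → ℕ) → foldr _+_ 0ℤ (map g (applyUpTo h m)) ≡ ∑ m (g ∘ h)
foldr-+-applyUpTo zero    g h = refl
foldr-+-applyUpTo (suc m) g h = cong (_+_ (g (h 0))) (foldr-+-applyUpTo m g (h ∘ suc))

∑-cong : ∀ m {g h : ℕ → ℤ} → (∀ i → i ℕ.< m → g i ≡ h i) → ∑ m g ≡ ∑ m h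
∑-cong zero    g≗h = refl
∑-cong (suc m) g≗h = cong₂ _+_ (g≗h 0 ℕ.z<s) (∑-cong m (λ i i<m → g≗h (suc i) (ℕ.s<s i<m)))

∑-split : ∀ m n (g : ℕ → ℤ) → ∑ (m ℕ.+ n) g ≡ ∑ m g + (∑[ i < n ] g (m ℕ.+ i))
∑-split zero    n g = sym (+-identityˡ _)
∑-split (suc m) n g = trans (cong (_+_ (g 0)) (∑-split m n (g ∘ suc))) (sym (+-assoc (g 0) _ _))

∑-0 : ∀ m → ∑[ i < m ] 0ℤ ≡ 0ℤ
∑-0 zero    = refl
∑-0 (suc m) = trans (+-identityˡ _) (∑-0 m)

∑-neg : ∀ m (g : ℕ → ℤ) → ∑[ i < m ] - g i ≡ - ∑ m g
∑-neg zero    g = refl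
∑-neg (suc m) g = trans (cong (_+_ (- g 0)) (∑-neg m (g ∘ suc))) (sym (neg-distrib-+ (g 0) _))

∑-+ : ∀ m (g h : ℕ → ℤ) → ∑[ i < m ] (g i + h i) ≡ ∑ m g + ∑ m h
∑-+ zero    g h = refl
∑-+ (suc m) g h = trans (cong (_+_ (g 0 + h 0)) (∑-+ m (g ∘ suc) (h ∘ suc))) (interchange (g 0) (h 0) _ _)
  where
  interchange : ∀ a b c d → a + b + (c + d) ≡ a + c + (b + d)
  interchange = solve-∀

∑-*ˡ : ∀ m k (g : ℕ → ℤ) → ∑[ i < m ] (k * g i) ≡ k * ∑ m g
∑-*ˡ zero    k g = sym (*-zeroʳ k)
∑-*ˡ (suc m) k g = trans (cong (_+_ (k * g 0)) (∑-*ˡ m k (g ∘ suc))) (sym (*-distribˡ-+ k (g 0) _))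

∑-telescope : ∀ N (f : ℕ → ℤ) → ∑[ n < N ] (f (suc n) - f n) ≡ f N - f 0
∑-telescope zero    f = sym (+-inverseʳ (f 0))
∑-telescope (suc N) f = trans (cong (_+_ (f 1 - f 0)) (∑-telescope N (f ∘ suc))) (collapse (f 0) (f 1) (f (suc N)))
  where
  collapse : ∀ x y z → y - x + (z - y) ≡ z - x
  collapse = solve-∀

ifZero : ℕ → ℤ → ℤ
ifZero zero    v = v
ifZero (suc _) v = 0ℤ

∑-multiples : ∀ m k (g : ℕ → ℤ) → ∑[ n < m ℕ.* suc k ] ifZero (n ℕ.% suc k) (g n) ≡ ∑[ i < m ] g (i ℕ.* suc k)
∑-multiples zero    k g = refl
∑-multiples (suc m) k g = begin
  ∑ (suc k ℕ.+ m ℕ.* suc k) G                                 ≡⟨ ∑-split (suc k) (m ℕ.* suc k) G ⟩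
  ∑ (suc k) G + (∑[ i < m ℕ.* suc k ] G (suc k ℕ.+ i))        ≡⟨ cong₂ _+_ first-block later-blocks ⟩
  g 0 + (∑[ i < m ] g (suc i ℕ.* suc k))                      ∎
  where
  G = λ n → ifZero (n ℕ.% suc k) (g n)
  first-block : ∑ (suc k) G ≡ g 0
  first-block = begin
    g 0 + (∑[ i < k ] ifZero (suc i ℕ.% suc k) (g (suc i)))  ≡⟨ cong (_+_ (g 0)) (∑-cong k λ i i<k →
                                                                   cong (λ r → ifZero r (g (suc i))) (ℕ.m<n⇒m%n≡m (ℕ.s<s i<k))) ⟩
    g 0 + (∑[ i < k ] 0ℤ)                                    ≡⟨ cong (_+_ (g 0)) (∑-0 k) ⟩
    g 0 + 0ℤ                                                 ≡⟨ +-identityʳ (g 0) ⟩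
    g 0                                                      ∎
  later-blocks : ∑[ i < m ℕ.* suc k ] G (suc k ℕ.+ i) ≡ ∑[ i < m ] g (suc i ℕ.* suc k)
  later-blocks = trans (∑-cong (m ℕ.* suc k) λ i _ → cong (λ r → ifZero r (g (suc k ℕ.+ i)))
                         (trans (cong (ℕ._% suc k) (ℕ.+-comm (suc k) i)) (ℕ.[m+n]%n≡m%n i (suc k))))
                       (∑-multiples m k (g ∘ (suc k ℕ.+_)))

Bezout : ℤ → ℤ → Set
Bezout a c = ∃₂ λ u v → u * a + v * c ≡ 1ℤ

Bezout-sym : ∀ {a c} → Bezout a c → Bezout c a
Bezout-sym {a} {c} (u , v , ua+vc≡1) = v , u , trans (+-comm (v * c) (u * a)) ua+vc≡1

Bezout-neg : ∀ {a c} → Bezout a c → Bezout (- a) (- c)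
Bezout-neg {a} {c} (u , v , ua+vc≡1) = - u , - v , trans (signs-cancel u a v c) ua+vc≡1
  where
  signs-cancel : ∀ u a v c → - u * - a + - v * - c ≡ u * a + v * c
  signs-cancel = solve-∀

Bezout-negˡ : ∀ {a c} → Bezout a c → Bezout (- a) c
Bezout-negˡ {a} {c} (u , v , ua+vc≡1) = - u , v , trans (signs-cancel u a v c) ua+vc≡1
  where
  signs-cancel : ∀ u a v c → - u * - a + v * c ≡ u * a + v * c
  signs-cancel = solve-∀

Bezout-zeroˡ : ∀ {y} → Bezout 0ℤ y → ∣ y ∣ ≡ 1
Bezout-zeroˡ {y} (u , v , u0+vy≡1) = ℕ.m*n≡1⇒n≡1 ∣ v ∣ ∣ y ∣ (trans (sym (abs-* v y)) (cong ∣_∣ vy≡1))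
  where
  vy≡1 : v * y ≡ 1ℤ
  vy≡1 = trans (sym (trans (cong (_+ v * y) (*-zeroʳ u)) (+-identityˡ (v * y)))) u0+vy≡1

Bezout⇒nonzero : ∀ {x y} → Bezout x y → ¬ (x ≡ 0ℤ × y ≡ 0ℤ)
Bezout⇒nonzero (u , v , u0+v0≡1) (refl , refl) with trans (sym (zeros u v)) u0+v0≡1
  where
  zeros : ∀ u v → u * 0ℤ + v * 0ℤ ≡ 0ℤ
  zeros = solve-∀
... | ()

det≡1⇒Bezout-row₂ : ∀ a b c d → a * d - b * c ≡ 1ℤ → Bezout c d
det≡1⇒Bezout-row₂ a b c d det≡1 = - b , a , trans (rearrange a b c d) det≡1
  where
  rearrange : ∀ a b c d → - b * c + a * d ≡ a * d - b * c
  rearrange = solve-∀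

det≡1⇒Bezout-col₁ : ∀ a b c d → a * d - b * c ≡ 1ℤ → Bezout a c
det≡1⇒Bezout-col₁ a b c d det≡1 = d , - b , trans (rearrange a b c d) det≡1
  where
  rearrange : ∀ a b c d → d * a + - b * c ≡ a * d - b * c
  rearrange = solve-∀

det≡1⇒Bezout-col₂ : ∀ a b c d → a * d - b * c ≡ 1ℤ → Bezout b d
det≡1⇒Bezout-col₂ a b c d det≡1 = - c , a , trans (rearrange a b c d) det≡1
  where
  rearrange : ∀ a b c d → - c * b + a * d ≡ a * d - b * c
  rearrange = solve-∀

Bezout-divisor : ∀ {a c} k → Bezout a c → c ∣ k * a → c ∣ k
Bezout-divisor {a} {c} k (u , v , ua+vc≡1) c∣ka = subst (c ∣_) k≡ (∣m∣n⇒∣m+n (∣n⇒∣m*n u c∣ka) (∣n⇒∣m*n (k * v) ∣-refl))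
  where
  k≡ : u * (k * a) + k * v * c ≡ k
  k≡ = begin
    u * (k * a) + k * v * c   ≡⟨ regroup u k a v c ⟩
    k * (u * a + v * c)       ≡⟨ cong (k *_) ua+vc≡1 ⟩
    k * 1ℤ                    ≡⟨ *-identityʳ k ⟩
    k                         ∎
    where
    regroup : ∀ u k a v c → u * (k * a) + k * v * c ≡ k * (u * a + v * c)
    regroup = solve-∀

Bezout-*-∣ : ∀ {a c k} → Bezout a c → a ∣ k → c ∣ k → a * c ∣ k
Bezout-*-∣ {a} {c} {k} bz (divides i k≡ia) c∣k with Bezout-divisor i bz (subst (c ∣_) k≡ia c∣k)
... | divides j i≡jc = divides j (trans k≡ia (trans (cong (_* a) i≡jc) (regroup j c a)))
  where
  regroup : ∀ j c a → j * c * a ≡ j * (a * c)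
  regroup = solve-∀

sgn-neg : ∀ x → sgn (- x) ≡ - sgn x
sgn-neg (+ zero)  = refl
sgn-neg +[1+ _ ]  = refl
sgn-neg -[1+ _ ]  = refl

sgn-* : ∀ x y → sgn (x * y) ≡ sgn x * sgn y
sgn-* (+ zero)  y          = refl
sgn-* +[1+ m ]  (+ zero)   = cong sgn (*-zeroʳ +[1+ m ])
sgn-* -[1+ m ]  (+ zero)   = cong sgn (*-zeroʳ -[1+ m ])
sgn-* +[1+ m ]  +[1+ n ]   = refl
sgn-* +[1+ m ]  -[1+ n ]   = refl
sgn-* -[1+ m ]  +[1+ n ]   = refl
sgn-* -[1+ m ]  -[1+ n ]   = refl

sgn-+ : ∀ x y → sgn x * sgn y ≡ -1ℤ ⊎ sgn (x + y) ≡ sgn (sgn x + sgn y)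
sgn-+ (+ zero)  (+ zero)   = inj₂ refl
sgn-+ (+ zero)  +[1+ n ]   = inj₂ refl
sgn-+ (+ zero)  -[1+ n ]   = inj₂ refl
sgn-+ +[1+ m ]  (+ zero)   = inj₂ refl
sgn-+ -[1+ m ]  (+ zero)   = inj₂ refl
sgn-+ +[1+ m ]  +[1+ n ]   = inj₂ refl
sgn-+ -[1+ m ]  -[1+ n ]   = inj₂ refl
sgn-+ +[1+ m ]  -[1+ n ]   = inj₁ refl
sgn-+ -[1+ m ]  +[1+ n ]   = inj₁ refl

signs : List ℤ
signs = -1ℤ ∷ 0ℤ ∷ 1ℤ ∷ []

sgn∈signs : ∀ x → sgn x ∈ signs
sgn∈signs (+ zero)  = there (here refl)
sgn∈signs +[1+ _ ]  = there (there (here refl))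
sgn∈signs -[1+ _ ]  = here refl

sgn≡0⇒≡0 : ∀ {x} → sgn x ≡ 0ℤ → x ≡ 0ℤ
sgn≡0⇒≡0 {+ zero} _ = refl

-- Identities between signs are decided by evaluating them on every pattern in {-1, 0, 1}.
AllSigns : (ℤ → Set) → Set
AllSigns P = All P signs

sgn-table-unimodular : AllSigns λ α → AllSigns λ β → AllSigns λ γ → AllSigns λ δ →
  (β * γ ≡ -1ℤ ⊎ α * δ ≡ sgn (1ℤ + β * γ)) → α * β + α * γ ≡ β * δ + γ * δ
sgn-table-unimodular = from-yes (all? (λ α → all? (λ β → all? (λ γ → all? (λ δ →
  (β * γ ≟ -1ℤ ⊎-dec α * δ ≟ sgn (1ℤ + β * γ)) →-dec (α * β + α * γ ≟ β * δ + γ * δ))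
  signs) signs) signs) signs)

sgn-unimodular : ∀ a b c d → a * d - b * c ≡ 1ℤ → sgn (a * b) + sgn (a * c) ≡ sgn (b * d) + sgn (c * d)
sgn-unimodular a b c d det≡1 = begin
  sgn (a * b) + sgn (a * c)  ≡⟨ cong₂ _+_ (sgn-* a b) (sgn-* a c) ⟩
  α * β + α * γ              ≡⟨ lookup (lookup (lookup (lookup sgn-table-unimodular (sgn∈signs a)) (sgn∈signs b))
                                  (sgn∈signs c)) (sgn∈signs d) sign-of-ad ⟩
  β * δ + γ * δ              ≡⟨ cong₂ _+_ (sgn-* b d) (sgn-* c d) ⟨
  sgn (b * d) + sgn (c * d)  ∎
  where
  α = sgn a
  β = sgn b
  γ = sgn c
  δ = sgn d
  ad≡1+bc : a * d ≡ 1ℤ + b * c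
  ad≡1+bc = trans (rearrange a b c d) (cong (_+ b * c) det≡1)
    where
    rearrange : ∀ a b c d → a * d ≡ a * d - b * c + b * c
    rearrange = solve-∀
  sign-of-ad : β * γ ≡ -1ℤ ⊎ α * δ ≡ sgn (1ℤ + β * γ)
  sign-of-ad with sgn-+ 1ℤ (b * c)
  ... | inj₁ opposite = inj₁ (trans (sym (sgn-* b c)) (trans (sym (*-identityˡ _)) opposite))
  ... | inj₂ same     = inj₂ (begin
    α * δ                    ≡⟨ sgn-* a d ⟨
    sgn (a * d)              ≡⟨ cong sgn ad≡1+bc ⟩
    sgn (1ℤ + b * c)         ≡⟨ same ⟩
    sgn (1ℤ + sgn (b * c))   ≡⟨ cong (λ s → sgn (1ℤ + s)) (sgn-* b c) ⟩
    sgn (1ℤ + β * γ)         ∎)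

sgn-table-pairing : AllSigns λ α → AllSigns λ β → AllSigns λ γ → AllSigns λ δ → AllSigns λ ω →
  (α * γ * (β * δ) ≡ -1ℤ ⊎ ω ≡ sgn (α * γ + β * δ)) → ¬ (α ≡ 0ℤ × β ≡ 0ℤ) → ¬ (γ ≡ 0ℤ × δ ≡ 0ℤ) →
  α * β + γ * δ ≡ β * γ * ω + α * δ * ω
sgn-table-pairing = from-yes (all? (λ α → all? (λ β → all? (λ γ → all? (λ δ → all? (λ ω →
  (α * γ * (β * δ) ≟ -1ℤ ⊎-dec ω ≟ sgn (α * γ + β * δ)) →-dec ¬? (α ≟ 0ℤ ×-dec β ≟ 0ℤ) →-dec
  ¬? (γ ≟ 0ℤ ×-dec δ ≟ 0ℤ) →-dec (α * β + γ * δ ≟ β * γ * ω + α * δ * ω))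
  signs) signs) signs) signs) signs)

sgn-pairing : ∀ u v p q → ¬ (u ≡ 0ℤ × v ≡ 0ℤ) → ¬ (p ≡ 0ℤ × q ≡ 0ℤ) →
  sgn (u * v) + sgn (p * q) ≡ sgn (v * p * (u * p + v * q)) + sgn (u * q * (u * p + v * q))
sgn-pairing u v p q uv≢0 pq≢0 = begin
  sgn (u * v) + sgn (p * q)            ≡⟨ cong₂ _+_ (sgn-* u v) (sgn-* p q) ⟩
  α * β + γ * δ                        ≡⟨ lookup (lookup (lookup (lookup (lookup sgn-table-pairing (sgn∈signs u)) (sgn∈signs v))
                                            (sgn∈signs p)) (sgn∈signs q)) (sgn∈signs w) sign-of-w (nonzero uv≢0) (nonzero pq≢0) ⟩
  β * γ * ω + α * δ * ω                ≡⟨ cong₂ _+_ (sgn-*³ v p w) (sgn-*³ u q w) ⟨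
  sgn (v * p * w) + sgn (u * q * w)    ∎
  where
  w = u * p + v * q
  α = sgn u
  β = sgn v
  γ = sgn p
  δ = sgn q
  ω = sgn w
  sgn-*³ : ∀ x y z → sgn (x * y * z) ≡ sgn x * sgn y * sgn z
  sgn-*³ x y z = trans (sgn-* (x * y) z) (cong (_* sgn z) (sgn-* x y))
  nonzero : ∀ {x y} → ¬ (x ≡ 0ℤ × y ≡ 0ℤ) → ¬ (sgn x ≡ 0ℤ × sgn y ≡ 0ℤ)
  nonzero xy≢0 (sx≡0 , sy≡0) = xy≢0 (sgn≡0⇒≡0 sx≡0 , sgn≡0⇒≡0 sy≡0)
  sign-of-w : α * γ * (β * δ) ≡ -1ℤ ⊎ ω ≡ sgn (α * γ + β * δ)
  sign-of-w with sgn-+ (u * p) (v * q)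
  ... | inj₁ opposite = inj₁ (trans (sym (cong₂ _*_ (sgn-* u p) (sgn-* v q))) opposite)
  ... | inj₂ same     = inj₂ (trans same (cong₂ (λ s t → sgn (s + t)) (sgn-* u p) (sgn-* v q)))

-- The sum 𝔰

-- 𝔰 a c is 𝔖 of any matrix with first column (a, c); the index j stands for k = j + 1.
𝔰-term : ℤ → ℤ → ℕ → ℤ
𝔰-term a c j = -1^ (floorDiv (+ suc j * a) c + + suc j + 1ℤ)

𝔰 : ℤ → ℤ → ℤ
𝔰 a c = ∑ (∣ c ∣ ℕ.∸ 1) (𝔰-term a c)

𝔖≡𝔰 : ∀ M → 𝔖 M ≡ 𝔰 (M2.a M) (M2.c M)
𝔖≡𝔰 (mat a b c d) = trans (foldr-+-applyUpTo (∣ c ∣ ℕ.∸ 1) _ id) (∑-cong (∣ c ∣ ℕ.∸ 1) λ j _ →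
  negOnePow≡-1^ (floorDiv (+ suc j * a) c + + suc j + 1ℤ))

𝔰-unit : ∀ a c → ∣ c ∣ ≡ 1 → 𝔰 a c ≡ 0ℤ
𝔰-unit a (+ 1)        refl = refl
𝔰-unit a -[1+ zero ]  refl = refl

𝔰-neg-neg : ∀ a c → 𝔰 (- a) (- c) ≡ 𝔰 a c
𝔰-neg-neg a (+ zero)  = refl
𝔰-neg-neg a +[1+ n ]  = ∑-cong n λ j _ →
  cong (λ z → -1^ (z /ℕ suc n + + suc j + 1ℤ)) (trans (cong -_ (sym (neg-distribʳ-* (+ suc j) a))) (neg-involutive _))
𝔰-neg-neg a -[1+ n ]  = ∑-cong n λ j _ →
  cong (λ z → -1^ (z /ℕ suc n + + suc j + 1ℤ)) (sym (neg-distribʳ-* (+ suc j) a))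

𝔰-periodic⁺ : ∀ a n t → 𝔰 (a + (t + t) * + suc n) (+ suc n) ≡ 𝔰 a (+ suc n)
𝔰-periodic⁺ a n t = ∑-cong n shift
  where
  shift : ∀ j → j ℕ.< n → 𝔰-term (a + (t + t) * + suc n) (+ suc n) j ≡ 𝔰-term a (+ suc n) j
  shift j _ = begin
    -1^ ((K * (a + (t + t) * + suc n)) /ℕ suc n + K + 1ℤ)  ≡⟨ cong (λ z → -1^ (z /ℕ suc n + K + 1ℤ)) (expand K a t (+ suc n)) ⟩
    -1^ ((K * a + K * (t + t) * + suc n) /ℕ suc n + K + 1ℤ) ≡⟨ cong (λ z → -1^ (z + K + 1ℤ)) (/ℕ-+-* (K * a) (K * (t + t)) (suc n)) ⟩
    -1^ (q + K * (t + t) + K + 1ℤ)                        ≡⟨ cong -1^_ (regroup q K t) ⟩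
    -1^ (q + K + 1ℤ + (K * t + K * t))                    ≡⟨ -1^-+-even (q + K + 1ℤ) (K * t) ⟩
    -1^ (q + K + 1ℤ)                                      ∎
    where
    K = + suc j
    q = (K * a) /ℕ suc n
    expand : ∀ K a t C → K * (a + (t + t) * C) ≡ K * a + K * (t + t) * C
    expand = solve-∀
    regroup : ∀ q K t → q + K * (t + t) + K + 1ℤ ≡ q + K + 1ℤ + (K * t + K * t)
    regroup = solve-∀

𝔰-periodic : ∀ a c t → 𝔰 (a + (t + t) * c) c ≡ 𝔰 a c
𝔰-periodic a (+ zero)  t = refl
𝔰-periodic a +[1+ n ]  t = 𝔰-periodic⁺ a n t
𝔰-periodic a c@(-[1+ n ]) t = begin
  𝔰 (a + (t + t) * c) c               ≡⟨ 𝔰-neg-neg (a + (t + t) * c) c ⟨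
  𝔰 (- (a + (t + t) * c)) +[1+ n ]    ≡⟨ cong (λ z → 𝔰 z +[1+ n ]) (negate a t (+ suc n)) ⟩
  𝔰 (- a + (t + t) * +[1+ n ]) +[1+ n ] ≡⟨ 𝔰-periodic⁺ (- a) n t ⟩
  𝔰 (- a) +[1+ n ]                    ≡⟨ 𝔰-neg-neg a c ⟩
  𝔰 a c                               ∎
  where
  negate : ∀ a t C → - (a + (t + t) * - C) ≡ - a + (t + t) * C
  negate = solve-∀

𝔰-neg⁺ : ∀ a n → Bezout a (+ suc n) → 𝔰 (- a) (+ suc n) ≡ - 𝔰 a (+ suc n)
𝔰-neg⁺ a n bz = trans (∑-cong n term-flips) (∑-neg n (𝔰-term a (+ suc n)))
  where
  term-flips : ∀ j → j ℕ.< n → 𝔰-term (- a) (+ suc n) j ≡ - 𝔰-term a (+ suc n) j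
  term-flips j j<n = begin
    -1^ ((K * - a) /ℕ suc n + K + 1ℤ)     ≡⟨ cong (λ z → -1^ (z /ℕ suc n + K + 1ℤ)) (neg-distribʳ-* K a) ⟨
    -1^ ((- (K * a)) /ℕ suc n + K + 1ℤ)   ≡⟨ cong (λ z → -1^ (z + K + 1ℤ)) (/ℕ-neg (K * a) (suc n) not-multiple) ⟩
    -1^ (- q - 1ℤ + K + 1ℤ)               ≡⟨ cong -1^_ (regroup q K) ⟩
    -1^ (q + K + 1ℤ + (- q + - q) - 1ℤ)   ≡⟨ -1^-pred (q + K + 1ℤ + (- q + - q)) ⟩
    - -1^ (q + K + 1ℤ + (- q + - q))      ≡⟨ cong -_ (-1^-+-even (q + K + 1ℤ) (- q)) ⟩
    - -1^ (q + K + 1ℤ)                    ∎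
    where
    K = + suc j
    q = (K * a) /ℕ suc n
    not-multiple : K * a ≢ q * + suc n
    not-multiple Ka≡qC = ℕ.<⇒≱ (ℕ.s<s j<n) (ℕ.∣⇒≤ (∣⇒∣ᵤ (Bezout-divisor K bz (divides q Ka≡qC))))
    regroup : ∀ q K → - q - 1ℤ + K + 1ℤ ≡ q + K + 1ℤ + (- q + - q) - 1ℤ
    regroup = solve-∀

𝔰-neg : ∀ a c → Bezout a c → 𝔰 (- a) c ≡ - 𝔰 a c
𝔰-neg a (+ zero)      _  = refl
𝔰-neg a +[1+ n ]      bz = 𝔰-neg⁺ a n bz
𝔰-neg a c@(-[1+ n ])  bz = begin
  𝔰 (- a) c                    ≡⟨ 𝔰-neg-neg (- a) c ⟨
  𝔰 (- - a) +[1+ n ]           ≡⟨ 𝔰-neg⁺ (- a) n (Bezout-neg bz) ⟩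
  - 𝔰 (- a) +[1+ n ]           ≡⟨ cong -_ (𝔰-neg-neg a c) ⟩
  - 𝔰 a c                      ∎

-- Reciprocity

-- H n = (-1)^(⌊n/X⌋ + ⌊n/Y⌋) changes sign at n + 1 < XY exactly when one of X, Y divides n + 1
-- (never both, by coprimality), so 2 D telescopes; on the other hand D collects H over the multiples
-- of X and of Y, whose sums are 1 - 𝔰 X Y and 1 - 𝔰 Y X.
module Reciprocity (p q : ℕ) (bz : Bezout (+ suc p) (+ suc q)) where

  X Y N₀ : ℕ
  X  = suc p
  Y  = suc q
  N₀ = q ℕ.+ p ℕ.* Y

  H : ℕ → ℤ
  H n = -1^ (+ (n ℕ./ X)) * -1^ (+ (n ℕ./ Y))

  D : ℕ → ℤ
  D n = ifZero (n ℕ.% X) (H n) + ifZero (n ℕ.% Y) (H n)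

  not-both-divide : ∀ n → suc n ℕ.< X ℕ.* Y → suc n ℕ.% X ≡ 0 → suc n ℕ.% Y ≡ 0 → ⊥
  not-both-divide n n<XY X∣n Y∣n = ℕ.<⇒≱ n<XY (ℕ.∣⇒≤ (∣⇒∣ᵤ (Bezout-*-∣ bz (divides-ℕ X∣n) (divides-ℕ Y∣n))))
    where
    divides-ℕ : ∀ {Z} .{{_ : ℕ.NonZero Z}} → suc n ℕ.% Z ≡ 0 → + Z ∣ + suc n
    divides-ℕ {Z} Z∣n = ∣ᵤ⇒∣ (ℕ.m%n≡0⇒n∣m (suc n) Z Z∣n)

  H-suc : ∀ n {i j} → suc n ℕ./ X ≡ i → suc n ℕ./ Y ≡ j → H (suc n) ≡ -1^ (+ i) * -1^ (+ j)
  H-suc n = cong₂ (λ i j → -1^ (+ i) * -1^ (+ j))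

  D-suc : ∀ n {r s} → suc n ℕ.% X ≡ r → suc n ℕ.% Y ≡ s → D (suc n) ≡ ifZero r (H (suc n)) + ifZero s (H (suc n))
  D-suc n = cong₂ (λ r s → ifZero r (H (suc n)) + ifZero s (H (suc n)))

  sign-change : ∀ n → - H (suc n) ≡ H n → + 2 * H (suc n) ≡ H (suc n) - H n
  sign-change n flipped = trans (double (H (suc n))) (cong (_-_ (H (suc n))) flipped)
    where
    double : ∀ h → + 2 * h ≡ h - - h
    double = solve-∀

  D-step : ∀ n → suc n ℕ.< X ℕ.* Y → + 2 * D (suc n) ≡ H (suc n) - H n
  D-step n n<XY with suc-/-% n X | suc-/-% n Y
  ... | inj₁ (X∣ , _)      | inj₁ (Y∣ , _)       = ⊥-elim (not-both-divide n n<XY X∣ Y∣)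
  ... | inj₁ (X∣ , ↑X)     | inj₂ (_ , Y∤ , =Y)  =
    trans (cong (+ 2 *_) (trans (D-suc n X∣ Y∤) (+-identityʳ _))) (sign-change n (begin
      - H (suc n)                                        ≡⟨ cong -_ (H-suc n ↑X =Y) ⟩
      - (-1^ (+ suc (n ℕ./ X)) * -1^ (+ (n ℕ./ Y)))      ≡⟨ cong (λ x → - (x * -1^ (+ (n ℕ./ Y)))) (-1^-+suc (n ℕ./ X)) ⟩
      - (- -1^ (+ (n ℕ./ X)) * -1^ (+ (n ℕ./ Y)))        ≡⟨ cong -_ (neg-distribˡ-* (-1^ (+ (n ℕ./ X))) (-1^ (+ (n ℕ./ Y)))) ⟨
      - - H n                                            ≡⟨ neg-involutive (H n) ⟩
      H n                                                ∎))
  ... | inj₂ (_ , X∤ , =X) | inj₁ (Y∣ , ↑Y)      =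
    trans (cong (+ 2 *_) (trans (D-suc n X∤ Y∣) (+-identityˡ _))) (sign-change n (begin
      - H (suc n)                                        ≡⟨ cong -_ (H-suc n =X ↑Y) ⟩
      - (-1^ (+ (n ℕ./ X)) * -1^ (+ suc (n ℕ./ Y)))      ≡⟨ cong (λ y → - (-1^ (+ (n ℕ./ X)) * y)) (-1^-+suc (n ℕ./ Y)) ⟩
      - (-1^ (+ (n ℕ./ X)) * - -1^ (+ (n ℕ./ Y)))        ≡⟨ cong -_ (neg-distribʳ-* (-1^ (+ (n ℕ./ X))) (-1^ (+ (n ℕ./ Y)))) ⟨
      - - H n                                            ≡⟨ neg-involutive (H n) ⟩
      H n                                                ∎))
  ... | inj₂ (_ , X∤ , =X) | inj₂ (_ , Y∤ , =Y)  =
    trans (cong (+ 2 *_) (D-suc n X∤ Y∤)) (sym (trans (cong (_- H n) (H-suc n =X =Y)) (+-inverseʳ (H n))))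

  ∑D-telescope : + 2 * ∑ (X ℕ.* Y) D ≡ + 3 + H N₀
  ∑D-telescope = begin
    + 2 * (D 0 + (∑[ n < N₀ ] D (suc n)))        ≡⟨ *-distribˡ-+ (+ 2) (D 0) (∑[ n < N₀ ] D (suc n)) ⟩
    + 4 + + 2 * (∑[ n < N₀ ] D (suc n))        ≡⟨ cong (_+_ (+ 4)) (∑-*ˡ N₀ (+ 2) (D ∘ suc)) ⟨
    + 4 + (∑[ n < N₀ ] (+ 2 * D (suc n)))      ≡⟨ cong (_+_ (+ 4)) (∑-cong N₀ λ n n<N₀ → D-step n (ℕ.s<s n<N₀)) ⟩
    + 4 + (∑[ n < N₀ ] (H (suc n) - H n))      ≡⟨ cong (_+_ (+ 4)) (∑-telescope N₀ H) ⟩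
    + 4 + (H N₀ - 1ℤ)                          ≡⟨ regroup (H N₀) ⟩
    + 3 + H N₀                                 ∎
    where
    regroup : ∀ h → + 4 + (h - 1ℤ) ≡ + 3 + h
    regroup = solve-∀

  H-N₀ : OppositeParity (+ X) (+ Y) → H N₀ ≡ -1ℤ
  H-N₀ opposite = begin
    H N₀                          ≡⟨ cong₂ (λ i j → -1^ (+ i) * -1^ (+ j)) N₀/X N₀/Y ⟩
    -1^ (+ q) * -1^ (+ p)         ≡⟨ *-comm (-1^ (+ q)) (-1^ (+ p)) ⟩
    -1^ (+ p) * -1^ (+ q)         ≡⟨ neg*neg (-1^ (+ p)) (-1^ (+ q)) ⟨
    - -1^ (+ p) * - -1^ (+ q)     ≡⟨ cong₂ _*_ (-1^-+suc p) (-1^-+suc q) ⟨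
    -1^ (+ X) * -1^ (+ Y)         ≡⟨ opposite ⟩
    -1ℤ                           ∎
    where
    neg*neg : ∀ x y → - x * - y ≡ x * y
    neg*neg = solve-∀
    N₀/Y : N₀ ℕ./ Y ≡ p
    N₀/Y = [r+kn]/n≡k q p Y ℕ.≤-refl
    N₀/X : N₀ ℕ./ X ≡ q
    N₀/X = trans (cong (ℕ._/ X) (swap p q)) ([r+kn]/n≡k p q X ℕ.≤-refl)
      where
      swap : ∀ p q → q ℕ.+ p ℕ.* suc q ≡ p ℕ.+ q ℕ.* suc p
      swap = ℕ-Solver.solve-∀

  H-multiple : ∀ j Z W .{{_ : ℕ.NonZero Z}} .{{_ : ℕ.NonZero W}} →
    -1^ (+ (suc j ℕ.* Z ℕ./ Z)) * -1^ (+ (suc j ℕ.* Z ℕ./ W)) ≡ - -1^ (+ (suc j ℕ.* Z ℕ./ W) + + suc j + 1ℤ)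
  H-multiple j Z W = begin
    -1^ (+ (suc j ℕ.* Z ℕ./ Z)) * -1^ (+ K)   ≡⟨ cong (λ i → -1^ (+ i) * -1^ (+ K)) (ℕ.m*n/n≡m (suc j) Z) ⟩
    -1^ (+ suc j) * -1^ (+ K)                ≡⟨ *-comm (-1^ (+ suc j)) (-1^ (+ K)) ⟩
    -1^ (+ K) * -1^ (+ suc j)                ≡⟨ neg-involutive _ ⟨
    - - (-1^ (+ K) * -1^ (+ suc j))          ≡⟨ cong -_ (trans (-1^-suc (+ K + + suc j)) (cong -_ (-1^-+ (+ K) (+ suc j)))) ⟨
    - -1^ (+ K + + suc j + 1ℤ)               ∎
    where
    K = suc j ℕ.* Z ℕ./ W

  ∑H-multiples-X : ∑[ k < Y ] H (k ℕ.* X) ≡ 1ℤ - 𝔰 (+ X) (+ Y)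
  ∑H-multiples-X = cong (_+_ 1ℤ) (trans (∑-cong q λ j _ → H-multiple j X Y) (∑-neg q (𝔰-term (+ X) (+ Y))))

  ∑H-multiples-Y : ∑[ k < X ] H (k ℕ.* Y) ≡ 1ℤ - 𝔰 (+ Y) (+ X)
  ∑H-multiples-Y = cong (_+_ 1ℤ) (trans (∑-cong p λ j _ → trans (*-comm (-1^ (+ (suc j ℕ.* Y ℕ./ X))) _) (H-multiple j Y X))
                                        (∑-neg p (𝔰-term (+ Y) (+ X))))

  ∑D-as-𝔰 : ∑ (X ℕ.* Y) D ≡ (1ℤ - 𝔰 (+ X) (+ Y)) + (1ℤ - 𝔰 (+ Y) (+ X))
  ∑D-as-𝔰 = begin
    ∑ (X ℕ.* Y) D
        ≡⟨ ∑-+ (X ℕ.* Y) (λ n → ifZero (n ℕ.% X) (H n)) (λ n → ifZero (n ℕ.% Y) (H n)) ⟩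
    (∑[ n < X ℕ.* Y ] ifZero (n ℕ.% X) (H n)) + (∑[ n < X ℕ.* Y ] ifZero (n ℕ.% Y) (H n))
        ≡⟨ cong₂ _+_ (trans (cong (λ m → ∑[ n < m ] ifZero (n ℕ.% X) (H n)) (ℕ.*-comm X Y)) (∑-multiples Y p H))
                     (∑-multiples X q H) ⟩
    (∑[ k < Y ] H (k ℕ.* X)) + (∑[ k < X ] H (k ℕ.* Y))     ≡⟨ cong₂ _+_ ∑H-multiples-X ∑H-multiples-Y ⟩
    (1ℤ - 𝔰 (+ X) (+ Y)) + (1ℤ - 𝔰 (+ Y) (+ X))             ∎

  reciprocity : OppositeParity (+ X) (+ Y) → 𝔰 (+ X) (+ Y) + 𝔰 (+ Y) (+ X) ≡ 1ℤ
  reciprocity opposite = begin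
    s₁ + s₂                               ≡⟨ regroup s₁ s₂ ⟩
    1ℤ + 1ℤ - ((1ℤ - s₁) + (1ℤ - s₂))     ≡⟨ cong (λ x → 1ℤ + 1ℤ - x) halves ⟩
    1ℤ                                    ∎
    where
    s₁ = 𝔰 (+ X) (+ Y)
    s₂ = 𝔰 (+ Y) (+ X)
    regroup : ∀ s₁ s₂ → s₁ + s₂ ≡ 1ℤ + 1ℤ - ((1ℤ - s₁) + (1ℤ - s₂))
    regroup = solve-∀
    halves : (1ℤ - s₁) + (1ℤ - s₂) ≡ 1ℤ
    halves = *-cancelˡ-≡ (+ 2) _ _ (begin
      + 2 * ((1ℤ - s₁) + (1ℤ - s₂))       ≡⟨ cong (+ 2 *_) ∑D-as-𝔰 ⟨
      + 2 * ∑ (X ℕ.* Y) D                 ≡⟨ ∑D-telescope ⟩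
      + 3 + H N₀                          ≡⟨ cong (_+_ (+ 3)) (H-N₀ opposite) ⟩
      + 2 * 1ℤ                            ∎)

reciprocity-negˡ : ∀ x y → Bezout x y → 𝔰 (- x) y + 𝔰 y (- x) ≡ - (𝔰 x y + 𝔰 y x)
reciprocity-negˡ x y bz = begin
  𝔰 (- x) y + 𝔰 y (- x)          ≡⟨ cong (λ z → 𝔰 (- x) y + 𝔰 z (- x)) (neg-involutive y) ⟨
  𝔰 (- x) y + 𝔰 (- - y) (- x)    ≡⟨ cong₂ _+_ (𝔰-neg x y bz) (trans (𝔰-neg-neg (- y) x) (𝔰-neg y x (Bezout-sym bz))) ⟩
  - 𝔰 x y + - 𝔰 y x              ≡⟨ neg-distrib-+ (𝔰 x y) (𝔰 y x) ⟨
  - (𝔰 x y + 𝔰 y x)              ∎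

𝔰-reciprocity⁺ : ∀ p y → Bezout (+ suc p) y → OppositeParity (+ suc p) y → 𝔰 (+ suc p) y + 𝔰 y (+ suc p) ≡ sgn (+ suc p * y)
𝔰-reciprocity⁺ p (+ zero)  bz _        = trans (+-identityˡ _) (trans (𝔰-unit 0ℤ (+ suc p) (Bezout-zeroˡ (Bezout-sym bz)))
                                           (cong sgn (sym (*-zeroʳ (+ suc p)))))
𝔰-reciprocity⁺ p +[1+ q ]  bz opposite = Reciprocity.reciprocity p q bz opposite
𝔰-reciprocity⁺ p -[1+ q ]  bz opposite = begin
  𝔰 X -[1+ q ] + 𝔰 -[1+ q ] X      ≡⟨ +-comm (𝔰 X -[1+ q ]) _ ⟩
  𝔰 -[1+ q ] X + 𝔰 X -[1+ q ]      ≡⟨ reciprocity-negˡ +[1+ q ] X bz′ ⟩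
  - (𝔰 +[1+ q ] X + 𝔰 X +[1+ q ])  ≡⟨ cong -_ (+-comm (𝔰 +[1+ q ] X) _) ⟩
  - (𝔰 X +[1+ q ] + 𝔰 +[1+ q ] X)  ≡⟨ cong -_ (Reciprocity.reciprocity p q (Bezout-sym bz′) opposite′) ⟩
  -1ℤ                              ∎
  where
  X = + suc p
  bz′ : Bezout +[1+ q ] X
  bz′ = Bezout-negˡ (Bezout-sym bz)
  opposite′ : OppositeParity X +[1+ q ]
  opposite′ = trans (cong (-1^ X *_) (sym (-1^-neg +[1+ q ]))) opposite

𝔰-reciprocity : ∀ x y → Bezout x y → OppositeParity x y → 𝔰 x y + 𝔰 y x ≡ sgn (x * y)
𝔰-reciprocity (+ zero)  y bz _        = trans (+-identityʳ _) (𝔰-unit 0ℤ y (Bezout-zeroˡ bz))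
𝔰-reciprocity +[1+ p ]  y bz opposite = 𝔰-reciprocity⁺ p y bz opposite
𝔰-reciprocity -[1+ p ]  y bz opposite = begin
  𝔰 -[1+ p ] y + 𝔰 y -[1+ p ]      ≡⟨ reciprocity-negˡ +[1+ p ] y (Bezout-negˡ bz) ⟩
  - (𝔰 +[1+ p ] y + 𝔰 y +[1+ p ])  ≡⟨ cong -_ (𝔰-reciprocity⁺ p y (Bezout-negˡ bz) opposite′) ⟩
  - sgn (+[1+ p ] * y)             ≡⟨ sgn-neg (+[1+ p ] * y) ⟨
  sgn (- (+[1+ p ] * y))           ≡⟨ cong sgn (neg-distribˡ-* +[1+ p ] y) ⟩
  sgn (-[1+ p ] * y)               ∎
  where
  opposite′ : OppositeParity +[1+ p ] y
  opposite′ = trans (cong (_* -1^ y) (sym (-1^-neg +[1+ p ]))) opposite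

𝔰-reciprocity′ : ∀ x y → Bezout x y → OppositeParity x y → 𝔰 x y ≡ sgn (x * y) - 𝔰 y x
𝔰-reciprocity′ x y bz x≢₂y = trans (add-sub (𝔰 x y) (𝔰 y x)) (cong (_- 𝔰 y x) (𝔰-reciprocity x y bz x≢₂y))
  where
  add-sub : ∀ s t → s ≡ s + t - t
  add-sub = solve-∀

-- Descent

-- For determinant 1 this is equivalent to membership in Γθ, and unlike the congruences defining Γθ
-- it is visibly preserved by left multiplication with (1 2t; 0 1) and with S.
record OddColumns (a b c d : ℤ) : Set where
  field
    det≡1     : a * d - b * c ≡ 1ℤ
    a≢₂c      : OppositeParity a c
    b≢₂d      : OppositeParity b d

OddColumns-shift : ∀ {a b c d} t → OddColumns a b c d → OddColumns (a + (t + t) * c) (b + (t + t) * d) c d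
OddColumns-shift {a} {b} {c} {d} t h = record
  { det≡1 = trans (det-invariant a b c d t) det≡1
  ; a≢₂c  = OppositeParity-shift a c t a≢₂c
  ; b≢₂d  = OppositeParity-shift b d t b≢₂d
  }
  where
  open OddColumns h
  det-invariant : ∀ a b c d t → (a + (t + t) * c) * d - (b + (t + t) * d) * c ≡ a * d - b * c
  det-invariant = solve-∀

OddColumns-swap : ∀ {a b c d} → OddColumns a b c d → OddColumns (- c) (- d) a b
OddColumns-swap {a} {b} {c} {d} h = record
  { det≡1 = trans (det-invariant a b c d) det≡1
  ; a≢₂c  = OppositeParity-swap a c a≢₂c
  ; b≢₂d  = OppositeParity-swap b d b≢₂d
  }
  where
  open OddColumns h
  det-invariant : ∀ a b c d → - c * b - - d * a ≡ a * d - b * c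
  det-invariant = solve-∀

𝔰-second-column-shift : ∀ a b c d t →
  𝔰 (b + (t + t) * d) d ≡ 𝔰 (a + (t + t) * c) c - sgn (c * d) → 𝔰 b d ≡ 𝔰 a c - sgn (c * d)
𝔰-second-column-shift a b c d t shifted =
  trans (sym (𝔰-periodic b d t)) (trans shifted (cong (_- sgn (c * d)) (𝔰-periodic a c t)))

𝔰-second-column-swap : ∀ {a b c d} → OddColumns a b c d →
  𝔰 (- d) b ≡ 𝔰 (- c) a - sgn (a * b) → 𝔰 b d ≡ 𝔰 a c - sgn (c * d)
𝔰-second-column-swap {a} {b} {c} {d} h swapped = begin
  𝔰 b d                                                 ≡⟨ 𝔰-reciprocity′ b d bz-bd b≢₂d ⟩
  sgn (b * d) - 𝔰 d b                                   ≡⟨ cong (_+_ (sgn (b * d))) (𝔰-neg d b (Bezout-sym bz-bd)) ⟨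
  sgn (b * d) + 𝔰 (- d) b                               ≡⟨ cong (_+_ (sgn (b * d))) swapped ⟩
  sgn (b * d) + (𝔰 (- c) a - sgn (a * b))               ≡⟨ cong (λ x → sgn (b * d) + (x - sgn (a * b))) (𝔰-neg c a bz-ca) ⟩
  sgn (b * d) + (- 𝔰 c a - sgn (a * b))                 ≡⟨ cong (λ x → sgn (b * d) + (- x - sgn (a * b))) recip-ca ⟩
  sgn (b * d) + (- (sgn (a * c) - 𝔰 a c) - sgn (a * b))  ≡⟨ regroup (sgn (b * d)) (sgn (a * c)) (𝔰 a c) (sgn (a * b)) ⟩
  𝔰 a c + (sgn (b * d) - (sgn (a * b) + sgn (a * c)))   ≡⟨ cong (λ x → 𝔰 a c + (sgn (b * d) - x)) (sgn-unimodular a b c d det≡1) ⟩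
  𝔰 a c + (sgn (b * d) - (sgn (b * d) + sgn (c * d)))   ≡⟨ cancel (𝔰 a c) (sgn (b * d)) (sgn (c * d)) ⟩
  𝔰 a c - sgn (c * d)                                   ∎
  where
  open OddColumns h
  bz-bd : Bezout b d
  bz-bd = det≡1⇒Bezout-col₂ a b c d det≡1
  bz-ca : Bezout c a
  bz-ca = Bezout-sym (det≡1⇒Bezout-col₁ a b c d det≡1)
  recip-ca : 𝔰 c a ≡ sgn (a * c) - 𝔰 a c
  recip-ca = trans (𝔰-reciprocity′ c a bz-ca (OppositeParity-sym a c a≢₂c)) (cong (λ x → sgn x - 𝔰 a c) (*-comm c a))
  regroup : ∀ p q r s → p + (- (q - r) - s) ≡ r + (p - (s + q))
  regroup = solve-∀
  cancel : ∀ r p q → r + (p - (p + q)) ≡ r - q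
  cancel = solve-∀

∣+m-+n∣<n : ∀ m k → 0 ℕ.< m → m ℕ.< suc k ℕ.+ suc k → ∣ + m - + suc k ∣ ℕ.< suc k
∣+m-+n∣<n m k 0<m m<2n with ℕ.≤-total m (suc k)
... | inj₁ m≤n = subst (ℕ._< suc k) (sym (trans (cong ∣_∣ (m-n≡m⊖n m (suc k))) (∣⊖∣-≤ m≤n))) (ℕ.∸-monoʳ-< 0<m m≤n)
... | inj₂ n≤m = subst (ℕ._< suc k) (sym (cong ∣_∣ (trans (m-n≡m⊖n m (suc k)) (⊖-≥ n≤m)))) (ℕ.m<n+o⇒m∸n<o m (suc k) m<2n)

-- a + 2sC is the representative of a in [-C, C) modulo 2C; parity rules out -C.
reduce-mod⁺ : ∀ a k → OppositeParity a (+ suc k) → ∃ λ s → ∣ a + (s + s) * + suc k ∣ ℕ.< suc k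
reduce-mod⁺ a k a≢₂C = candidate (A %ℕ (C ℕ.+ C)) (n%ℕd<d A (C ℕ.+ C)) (a≡a%ℕn+[a/ℕn]*n A (C ℕ.+ C))
  where
  C = suc k
  A = a + + C
  Q = A /ℕ (C ℕ.+ C)
  representative : ∀ r → A ≡ + r + Q * + (C ℕ.+ C) → a + (- Q + - Q) * + C ≡ + r - + C
  representative r A≡ = begin
    a + (- Q + - Q) * + C                        ≡⟨ expand a Q (+ C) ⟩
    a + + C - + C - Q * (+ C + + C)              ≡⟨ cong₂ (λ x y → x - + C - Q * y) A≡ (sym (pos-+ C C)) ⟩
    + r + Q * + (C ℕ.+ C) - + C - Q * + (C ℕ.+ C) ≡⟨ cancel (+ r) Q (+ C) (+ (C ℕ.+ C)) ⟩
    + r - + C                                    ∎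
    where
    expand : ∀ a Q C → a + (- Q + - Q) * C ≡ a + C - C - Q * (C + C)
    expand = solve-∀
    cancel : ∀ r Q C D → r + Q * D - C - Q * D ≡ r - C
    cancel = solve-∀
  candidate : ∀ r → r ℕ.< C ℕ.+ C → A ≡ + r + Q * + (C ℕ.+ C) → ∃ λ s → ∣ a + (s + s) * + C ∣ ℕ.< C
  candidate zero    _    A≡ = ⊥-elim (¬OppositeParity-neg (+ C)
    (subst (λ x → OppositeParity x (+ C)) (representative 0 A≡) (OppositeParity-shift a (+ C) (- Q) a≢₂C)))
  candidate (suc r) r<2C A≡ = - Q , subst (λ x → ∣ x ∣ ℕ.< C) (sym (representative (suc r) A≡)) (∣+m-+n∣<n (suc r) k ℕ.z<s r<2C)

reduce-mod : ∀ a c → OppositeParity a c → c ≢ 0ℤ → ∃ λ t → ∣ a + (t + t) * c ∣ ℕ.< ∣ c ∣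
reduce-mod a (+ zero)  _    c≢0 = ⊥-elim (c≢0 refl)
reduce-mod a +[1+ k ]  a≢₂c _   = reduce-mod⁺ a k a≢₂c
reduce-mod a -[1+ k ]  a≢₂c _   with reduce-mod⁺ a k (trans (cong (-1^ a *_) (sym (-1^-neg-suc k))) a≢₂c)
... | s , small = - s , subst (λ x → ∣ x ∣ ℕ.< suc k) (negate a s (+ suc k)) small
  where
  negate : ∀ a s C → a + (s + s) * C ≡ a + (- s + - s) * - C
  negate = solve-∀

-- Descent on |c|: a shift makes |a| < |c|, and multiplying by S on the left then exchanges a and c.
𝔰-second-column : ∀ {a b c d} → OddColumns a b c d → 𝔰 b d ≡ 𝔰 a c - sgn (c * d)
𝔰-second-column {c = c} = descent (suc ∣ c ∣) ℕ.≤-refl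
  where
  descent : ∀ n {a b c d} → ∣ c ∣ ℕ.< n → OddColumns a b c d → 𝔰 b d ≡ 𝔰 a c - sgn (c * d)
  descent (suc n) {a} {b} {c} {d} |c|<1+n h with c ≟ 0ℤ
  ... | yes refl   = 𝔰-unit b d (Bezout-zeroˡ (det≡1⇒Bezout-row₂ a b 0ℤ d (OddColumns.det≡1 h)))
  ... | no  c≢0    with reduce-mod a c (OddColumns.a≢₂c h) c≢0
  ...   | t , small = 𝔰-second-column-shift a b c d t
                        (𝔰-second-column-swap h′ (descent n (ℕ.<-≤-trans small (ℕ.s≤s⁻¹ |c|<1+n)) (OddColumns-swap h′)))
    where
    h′ = OddColumns-shift t h

-- The action of S

InΓθ⇒OddColumns : ∀ a b c d → InΓθ (mat a b c d) → OddColumns a b c d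
InΓθ⇒OddColumns a b c d (det≡1 , a≡₂d , b≡₂c) with ≡₂⇒+even a d a≡₂d | ≡₂⇒+even b c b≡₂c
... | t , refl | u , refl = record
  { det≡1 = det≡1
  ; a≢₂c  = trans (cong (_* -1^ c) (-1^-+-even d t)) d≢₂c
  ; b≢₂d  = trans (cong (_* -1^ d) (-1^-+-even c u)) (trans (*-comm (-1^ c) (-1^ d)) d≢₂c)
  }
  where
  v = t * d - u * c
  d≢₂c : OppositeParity d c
  d≢₂c = begin
    -1^ d * -1^ c                          ≡⟨ cong₂ _*_ (-1^-square d) (trans (-1^-neg (c * c)) (-1^-square c)) ⟨
    -1^ (d * d) * -1^ (- (c * c))          ≡⟨ -1^-+ (d * d) (- (c * c)) ⟨
    -1^ (d * d - c * c)                    ≡⟨ -1^-+-even (d * d - c * c) v ⟨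
    -1^ (d * d - c * c + (v + v))          ≡⟨ cong -1^_ (det-expand t u c d) ⟩
    -1^ ((d + (t + t)) * d - (c + (u + u)) * c) ≡⟨ cong -1^_ det≡1 ⟩
    -1ℤ                                    ∎
    where
    det-expand : ∀ t u c d → d * d - c * c + ((t * d - u * c) + (t * d - u * c)) ≡ (d + (t + t)) * d - (c + (u + u)) * c
    det-expand = solve-∀

δ𝔖 : M2 → M2 → ℤ
δ𝔖 A B = 𝔖 (A · B) - 𝔖 A - 𝔖 B

sgn-cocycle : M2 → M2 → ℤ
sgn-cocycle A B = - sgn (c A * c B * c (A · B))

𝔖-·S : ∀ A → InΓθ A → 𝔖 (A · S) ≡ 𝔖 A - sgn (c A * d A)
𝔖-·S A@(mat a b c d) A∈Γθ = begin
  𝔖 (A · S)                               ≡⟨ 𝔖≡𝔰 (A · S) ⟩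
  𝔰 (a * 0ℤ + b * 1ℤ) (c * 0ℤ + d * 1ℤ)   ≡⟨ cong₂ 𝔰 (second-column a b) (second-column c d) ⟩
  𝔰 b d                                   ≡⟨ 𝔰-second-column (InΓθ⇒OddColumns a b c d A∈Γθ) ⟩
  𝔰 a c - sgn (c * d)                     ≡⟨ cong (_- sgn (c * d)) (𝔖≡𝔰 A) ⟨
  𝔖 A - sgn (c * d)                       ∎
  where
  second-column : ∀ x y → x * 0ℤ + y * 1ℤ ≡ y
  second-column = solve-∀

𝔖-S· : ∀ B → InΓθ B → 𝔖 (S · B) ≡ 𝔖 B - sgn (a B * c B)
𝔖-S· B@(mat a b c d) B∈Γθ = begin
  𝔖 (S · B)                               ≡⟨ 𝔖≡𝔰 (S · B) ⟩
  𝔰 (0ℤ * a + -1ℤ * c) (1ℤ * a + 0ℤ * c)  ≡⟨ cong₂ 𝔰 (negate a c) (first a c) ⟩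
  𝔰 (- c) a                               ≡⟨ 𝔰-neg c a bz-ca ⟩
  - 𝔰 c a                                 ≡⟨ cong -_ (𝔰-reciprocity′ c a bz-ca (OppositeParity-sym a c a≢₂c)) ⟩
  - (sgn (c * a) - 𝔰 a c)                 ≡⟨ ⁻¹-anti-homo‿- (sgn (c * a)) (𝔰 a c) ⟩
  𝔰 a c - sgn (c * a)                     ≡⟨ cong₂ (λ x y → x - sgn y) (𝔖≡𝔰 B) (*-comm a c) ⟨
  𝔖 B - sgn (a * c)                       ∎
  where
  open OddColumns (InΓθ⇒OddColumns a b c d B∈Γθ)
  bz-ca : Bezout c a
  bz-ca = Bezout-sym (det≡1⇒Bezout-col₁ a b c d det≡1)
  negate : ∀ a c → 0ℤ * a + -1ℤ * c ≡ - c
  negate = solve-∀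
  first : ∀ a c → 1ℤ * a + 0ℤ * c ≡ a
  first = solve-∀

𝔖-·S·S· : ∀ A B → 𝔖 ((A · S) · (S · B)) ≡ 𝔖 (A · B)
𝔖-·S·S· A@(mat a₁ b₁ c₁ d₁) B@(mat a₂ b₂ c₂ d₂) = begin
  𝔖 ((A · S) · (S · B))                                   ≡⟨ 𝔖≡𝔰 ((A · S) · (S · B)) ⟩
  𝔰 (a ((A · S) · (S · B))) (c ((A · S) · (S · B)))       ≡⟨ cong₂ 𝔰 (negated a₁ b₁ a₂ c₂) (negated c₁ d₁ a₂ c₂) ⟩
  𝔰 (- (a₁ * a₂ + b₁ * c₂)) (- (c₁ * a₂ + d₁ * c₂))       ≡⟨ 𝔰-neg-neg (a₁ * a₂ + b₁ * c₂) (c₁ * a₂ + d₁ * c₂) ⟩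
  𝔰 (a₁ * a₂ + b₁ * c₂) (c₁ * a₂ + d₁ * c₂)               ≡⟨ 𝔖≡𝔰 (A · B) ⟨
  𝔖 (A · B)                                               ∎
  where
  negated : ∀ x y a₂ c₂ →
    (x * 0ℤ + y * 1ℤ) * (0ℤ * a₂ + -1ℤ * c₂) + (x * -1ℤ + y * 0ℤ) * (1ℤ * a₂ + 0ℤ * c₂) ≡ - (x * a₂ + y * c₂)
  negated = solve-∀

δ𝔖-·S-S· : ∀ A B → InΓθ A → InΓθ B → δ𝔖 (A · S) (S · B) ≡ δ𝔖 A B + (sgn (c A * d A) + sgn (a B * c B))
δ𝔖-·S-S· A B A∈Γθ B∈Γθ = begin
  𝔖 ((A · S) · (S · B)) - 𝔖 (A · S) - 𝔖 (S · B)          ≡⟨ cong₂ (λ x y → x - y - 𝔖 (S · B)) (𝔖-·S·S· A B) (𝔖-·S A A∈Γθ) ⟩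
  𝔖 (A · B) - (𝔖 A - s₁) - 𝔖 (S · B)                     ≡⟨ cong (_-_ (𝔖 (A · B) - (𝔖 A - s₁))) (𝔖-S· B B∈Γθ) ⟩
  𝔖 (A · B) - (𝔖 A - s₁) - (𝔖 B - s₂)                    ≡⟨ regroup (𝔖 (A · B)) (𝔖 A) (𝔖 B) s₁ s₂ ⟩
  δ𝔖 A B + (s₁ + s₂)                                     ∎
  where
  s₁ = sgn (c A * d A)
  s₂ = sgn (a B * c B)
  regroup : ∀ x y z s₁ s₂ → x - (y - s₁) - (z - s₂) ≡ x - y - z + (s₁ + s₂)
  regroup = solve-∀

sgn-cocycle-·S-S· : ∀ A B → det A ≡ 1ℤ → det B ≡ 1ℤ →
  sgn-cocycle (A · S) (S · B) ≡ sgn-cocycle A B + (sgn (c A * d A) + sgn (a B * c B))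
sgn-cocycle-·S-S· A@(mat a₁ b₁ c₁ d₁) B@(mat a₂ b₂ c₂ d₂) detA≡1 detB≡1 = begin
  - sgn (c (A · S) * c (S · B) * c ((A · S) · (S · B)))   ≡⟨ cong (-_ ∘ sgn) (entries c₁ d₁ a₂ c₂) ⟩
  - sgn (- (d₁ * a₂ * w))                                 ≡⟨ cong -_ (sgn-neg (d₁ * a₂ * w)) ⟩
  - - sgn (d₁ * a₂ * w)                                   ≡⟨ neg-involutive _ ⟩
  sgn (d₁ * a₂ * w)                                       ≡⟨ regroup (sgn (d₁ * a₂ * w)) (sgn (c₁ * c₂ * w)) ⟩
  - sgn (c₁ * c₂ * w) + (sgn (d₁ * a₂ * w) + sgn (c₁ * c₂ * w))
      ≡⟨ cong (_+_ (- sgn (c₁ * c₂ * w))) (sgn-pairing c₁ d₁ a₂ c₂ row≢0 column≢0) ⟨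
  - sgn (c₁ * c₂ * w) + (sgn (c₁ * d₁) + sgn (a₂ * c₂))   ∎
  where
  w = c₁ * a₂ + d₁ * c₂
  row≢0 : ¬ (c₁ ≡ 0ℤ × d₁ ≡ 0ℤ)
  row≢0 = Bezout⇒nonzero (det≡1⇒Bezout-row₂ a₁ b₁ c₁ d₁ detA≡1)
  column≢0 : ¬ (a₂ ≡ 0ℤ × c₂ ≡ 0ℤ)
  column≢0 = Bezout⇒nonzero (det≡1⇒Bezout-col₁ a₂ b₂ c₂ d₂ detB≡1)
  entries : ∀ c₁ d₁ a₂ c₂ → (c₁ * 0ℤ + d₁ * 1ℤ) * (1ℤ * a₂ + 0ℤ * c₂)
      * ((c₁ * 0ℤ + d₁ * 1ℤ) * (0ℤ * a₂ + -1ℤ * c₂) + (c₁ * -1ℤ + d₁ * 0ℤ) * (1ℤ * a₂ + 0ℤ * c₂))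
      ≡ - (d₁ * a₂ * (c₁ * a₂ + d₁ * c₂))
  entries = solve-∀
  regroup : ∀ x y → x ≡ - y + (x + y)
  regroup = solve-∀

lemma6 : (A B : M2) → InΓθ A → InΓθ B →
    Rel A B ⇔ Rel (A · S) (S · B)
lemma6 A B A∈Γθ B∈Γθ = mk⇔
  (λ rel → trans (δ𝔖-·S-S· A B A∈Γθ B∈Γθ) (trans (cong (_+ k) rel) (sym cocycle≡)))
  (λ rel′ → ∙-cancelʳ k (δ𝔖 A B) (sgn-cocycle A B) (trans (sym (δ𝔖-·S-S· A B A∈Γθ B∈Γθ)) (trans rel′ cocycle≡)))
  where
  k = sgn (c A * d A) + sgn (a B * c B)
  cocycle≡ : sgn-cocycle (A · S) (S · B) ≡ sgn-cocycle A B + k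
  cocycle≡ = sgn-cocycle-·S-S· A B (proj₁ A∈Γθ) (proj₁ B∈Γθ)
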